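{- For every $n\ge 2$, the hypercube $Q_n$ is a square.
   Context: $Q_n$ is the graph whose vertices are the binary $n$-tuples, two being adjacent iff they differ in exactly one coordinate. All graphs are finite and simple. A partially labeled graph is a graph $H$ together with an injective map $\theta: L\to V(H)$, $L\subseteq\mathbb{N}$, whose image $\theta(L)$ is nonempty and a proper subset of $V(H)$; vertices in $\theta(L)$ are labeled. The square $HH$ is obtained from two disjoint copies of $H$ by identifying each labeled vertex $\theta(\ell)$ of the first copy with $\theta(\ell)$ of the second copy (keeping all edges, merging double edges). A graph $G$ is a square if $G\cong HH$ for some partially labeled graph $H$. -}

module Defs where

open import Data.Nat using (ℕ; _≥_)
open import Data.Bool using (Bool; T; not)
open import Data.Fin using (Fin; _≟_)
open import Data.Vec using (Vec; lookup)
open import Data.Sum using (_⊎_; inj₁; inj₂)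
open import Data.Product using (Σ; Σ-syntax; ∃; ∃-syntax; _×_; _,_)
open import Data.Empty using (⊥)
open import Relation.Nullary using (¬_; does)
open import Relation.Binary.PropositionalEquality using (_≡_; _≢_; refl; subst) renaming (sym to ≡-sym)
open import Function.Definitions using (Injective)
open import Function.Bundles using (_⤖_; Bijection)
open import Data.Fin.Properties using (any?)
open import Level using (0ℓ)

record Graph : Set₁ where
  field
    V   : Set
    Adj : V → V → Set
open Graph public

record SimpleGraph (m : ℕ) : Set₁ where
  field
    Adj   : Fin m → Fin m → Set
    symm  : ∀ {u v} → Adj u v → Adj v u
    irrefl : ∀ {u} → ¬ Adj u u
open SimpleGraph public

toGraph : ∀ {m} → SimpleGraph m → Graph
toGraph {m} H = record { V = Fin m ; Adj = SimpleGraph.Adj H }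

record _≅_ (G H : Graph) : Set₁ where
  field
    bij      : V G ⤖ V H
  open Bijection bij public using (to)
  field
    preserve : ∀ x y → Adj G x y → Adj H (to x) (to y)
    reflect  : ∀ x y → Adj H (to x) (to y) → Adj G x y

Q : ℕ → Graph
Q n = record
  { V   = Vec Bool n
  ; Adj = λ x y → Σ[ i ∈ Fin n ] (lookup x i ≢ lookup y i
                    × (∀ j → j ≢ i → lookup x j ≡ lookup y j))
  }

-- The label set L ⊆ ℕ is finite (θ is
-- injective into a finite set), so it is given as an injective
-- enumeration  lab : Fin k → ℕ,  and θ is given on Fin k, i.e.
-- θ(lab i) = vert i.  θ injective, image nonempty (k ≥ 1) and proper.

record PLGraph : Set₁ where
  field
    m      : ℕ
    H      : SimpleGraph m
    k      : ℕ
    lab    : Fin k → ℕ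
    lab-inj : Injective _≡_ _≡_ lab
    vert   : Fin k → Fin m
    vert-inj : Injective _≡_ _≡_ vert
    nonempty : k ≥ 1
    proper : Σ[ v ∈ Fin m ] (∀ i → vert i ≢ v)

  labeledᵇ : Fin m → Bool
  labeledᵇ v = does (any? (λ i → vert i ≟ v))

  -- Vertices of HH: all vertices of the first copy, plus the unlabeled
  -- vertices of the second copy (labeled ones are identified).
  SqV : Set
  SqV = Fin m ⊎ Σ[ v ∈ Fin m ] T (not (labeledᵇ v))

  ι₁ : Fin m → SqV
  ι₁ v = inj₁ v

  ι₂ : Fin m → SqV
  ι₂ v = pick v (labeledᵇ v) refl
    where
    pick : (v : Fin m) (b : Bool) → labeledᵇ v ≡ b → SqV
    pick v Bool.true  _ = inj₁ v
    pick v Bool.false e = inj₂ (v , subst (λ c → T (not c)) (≡-sym e) _)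

  SqAdj : SqV → SqV → Set
  SqAdj x y =
      (Σ[ u ∈ Fin m ] Σ[ w ∈ Fin m ] (SimpleGraph.Adj H u w × ι₁ u ≡ x × ι₁ w ≡ y))
    ⊎ (Σ[ u ∈ Fin m ] Σ[ w ∈ Fin m ] (SimpleGraph.Adj H u w × ι₂ u ≡ x × ι₂ w ≡ y))

square : PLGraph → Graph
square P = record { V = PLGraph.SqV P ; Adj = PLGraph.SqAdj P }

IsSquare : Graph → Set₁
IsSquare G = Σ[ P ∈ PLGraph ] (G ≅ square P)

-- Split the vertices of Q (2 + n) by their first two coordinates and let H be
-- the subgraph induced by the 01-, 00- and 11-vertices, with the 00- and
-- 11-vertices labeled.  Swapping the first two coordinates is an automorphism
-- that fixes the labeled vertices and exchanges the 01- and 10-vertices, and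
-- no 01-vertex is adjacent to a 10-vertex since they differ in two
-- coordinates; hence Q (2 + n) ≅ HH.  The argument works for any simple graph
-- whose vertices split as A ⊔ F ⊔ A′ such that A ⊔ F and A′ ⊔ F induce the
-- same graph and no edge joins A to A′.

module Submission where

open import Defs
open import Data.Nat using (ℕ; suc; _+_; _^_; _≥_; s≤s; >-nonZero⁻¹)
open import Data.Bool using (Bool; true; false; T; not)
open import Data.Bool.Properties using (T-irrelevant)
open import Data.Empty using (⊥-elim)
open import Data.Fin using (Fin; suc; toℕ; _≟_)
open import Data.Fin.Patterns using (0F; 1F)
open import Data.Fin.Properties using (any?; toℕ-injective; +↔⊎; 2↔Bool; nonZeroIndex)
open import Data.Fin.Permutation using (Permutation′; _⟨$⟩ʳ_; _⟨$⟩ˡ_; inverseˡ; inverseʳ; transpose)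
open import Data.Vec using (Vec; _∷_; lookup; replicate)
open import Data.Vec.Recursive using (Fin[m^n]↔Fin[m]^n; lift↔)
open import Data.Vec.Recursive.Properties using (↔Vec)
open import Data.Sum using (_⊎_; inj₁; inj₂; [_,_])
open import Data.Sum.Properties using (inj₂-injective)
open import Data.Sum.Function.Propositional using (_⊎-↔_)
open import Data.Product using (_,_)
open import Data.Unit using (⊤; tt)
open import Function using (_∘_; _↔_; _⇔_; Inverse; Injection; Equivalence; mk↔ₛ′; mk⇔)
open import Function.Definitions using (Injective)
open import Function.Properties.Inverse using (↔-trans; ↔-sym; ↔⇒⤖; ↔⇒↣)
open import Relation.Nullary using (¬_; yes; no; does)
open import Relation.Binary.PropositionalEquality
  using (_≡_; _≢_; refl; sym; trans; cong; subst; subst₂; module ≡-Reasoning)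

to-injective : {A B : Set} (f : A ↔ B) → Injective _≡_ _≡_ (Inverse.to f)
to-injective f = Injection.injective (↔⇒↣ f)

from-injective : {A B : Set} (f : A ↔ B) → Injective _≡_ _≡_ (Inverse.from f)
from-injective f = to-injective (↔-sym f)

-- ι₂ v is defined by matching on the pair (labeledᵇ v , refl), so a plain
-- with on labeledᵇ v is ill-typed.  Reading the graph through a variable
-- t : ⊤ gives a copy of labeledᵇ v that is convertible to it (η for ⊤)
-- but is not abstracted, which keeps the refl well-typed.
private
  module ι₂-cases (P : ⊤ → PLGraph) (t : ⊤) (v : Fin (PLGraph.m (P tt))) where
    open PLGraph

    labeledᵇ-at-t : does (any? (λ i → vert (P t) i ≟ v)) ≡ labeledᵇ (P tt) v
    labeledᵇ-at-t = refl

    labeled : labeledᵇ (P tt) v ≡ true → ι₂ (P tt) v ≡ inj₁ v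
    labeled _ with labeledᵇ (P tt) v | labeledᵇ-at-t
    ... | true | _ = refl

    unlabeled : (u : T (not (does (any? (λ i → vert (P t) i ≟ v))))) →
                ι₂ (P tt) v ≡ inj₂ (v , u)
    unlabeled u with labeledᵇ (P tt) v | labeledᵇ-at-t
    ... | false | _ = cong (λ u′ → inj₂ (v , u′)) (T-irrelevant _ u)
    ... | true  | e = ⊥-elim (subst (λ b → T (not b)) e u)

module _ (P : PLGraph) where
  open PLGraph P

  labeledᵇ-vert : ∀ {v} i → vert i ≡ v → labeledᵇ v ≡ true
  labeledᵇ-vert {v} i e with any? (λ j → vert j ≟ v)
  ... | yes _  = refl
  ... | no ¬∃ = ⊥-elim (¬∃ (i , e))

  unlabeled : ∀ {v} → (∀ i → vert i ≢ v) → T (not (labeledᵇ v))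
  unlabeled {v} ∉vert with any? (λ j → vert j ≟ v)
  ... | yes (i , e) = ⊥-elim (∉vert i e)
  ... | no _        = tt

  ι₂-vert : ∀ {v} i → vert i ≡ v → ι₂ v ≡ inj₁ v
  ι₂-vert {v} i e = ι₂-cases.labeled (λ _ → P) tt v (labeledᵇ-vert i e)

  ι₂-unlabeled : ∀ v (u : T (not (labeledᵇ v))) → ι₂ v ≡ inj₂ (v , u)
  ι₂-unlabeled = ι₂-cases.unlabeled (λ _ → P) tt

-- A vertex set Outer ⊎ Fixed ⊎ Outer consists of the unlabeled vertices of
-- the first copy of H, the labeled vertices, and the unlabeled vertices of
-- the second copy; copy₁ and copy₂ embed the vertices Outer ⊎ Fixed of H as
-- the two copies.
copy₁ copy₂ : {A F : Set} → A ⊎ F → A ⊎ F ⊎ A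
copy₁ = [ inj₁ , inj₂ ∘ inj₁ ]
copy₂ = [ inj₂ ∘ inj₂ , inj₂ ∘ inj₁ ]

record SquareDecomposition (G : Graph) : Set₁ where
  field
    Outer Fixed    : Set
    #outer #fixed  : ℕ
    enumOuter      : Fin #outer ↔ Outer
    enumFixed      : Fin #fixed ↔ Fixed
    outer₀         : Outer
    fixed₀         : Fixed
    vertices       : (Outer ⊎ Fixed ⊎ Outer) ↔ V G
    copies-agree   : ∀ w w′ →
      Adj G (Inverse.to vertices (copy₁ w)) (Inverse.to vertices (copy₁ w′)) ⇔
      Adj G (Inverse.to vertices (copy₂ w)) (Inverse.to vertices (copy₂ w′))
    no-cross-edges : ∀ a a′ →
      ¬ Adj G (Inverse.to vertices (inj₁ a)) (Inverse.to vertices (inj₂ (inj₂ a′)))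

module _ {G : Graph} (Adj-sym : ∀ x y → Adj G x y → Adj G y x)
         (Adj-irrefl : ∀ x → ¬ Adj G x x) (D : SquareDecomposition G) where
  open SquareDecomposition D
  private
    module Vtx = Inverse vertices

    m : ℕ
    m = #outer + #fixed

    index : Fin m ↔ (Outer ⊎ Fixed)
    index = ↔-trans +↔⊎ (enumOuter ⊎-↔ enumFixed)
    module Idx = Inverse index

    H : SimpleGraph m
    H = record
      { Adj    = λ u w → Adj G (Vtx.to (copy₁ (Idx.to u))) (Vtx.to (copy₁ (Idx.to w)))
      ; symm   = Adj-sym _ _
      ; irrefl = Adj-irrefl _
      }

    label : Fin #fixed → Fin m
    label i = Idx.from (inj₂ (Inverse.to enumFixed i))

    label≢outer : ∀ a i → label i ≢ Idx.from (inj₁ a)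
    label≢outer a i e with from-injective index {inj₂ (Inverse.to enumFixed i)} {inj₁ a} e
    ... | ()

    P : PLGraph
    P = record
      { m        = m
      ; H        = H
      ; k        = #fixed
      ; lab      = toℕ
      ; lab-inj  = toℕ-injective
      ; vert     = label
      ; vert-inj = to-injective enumFixed ∘ inj₂-injective ∘ from-injective index
      ; nonempty = >-nonZero⁻¹ #fixed {{nonZeroIndex (Inverse.from enumFixed fixed₀)}}
      ; proper   = Idx.from (inj₁ outer₀) , label≢outer outer₀
      }
    open PLGraph P using (SqV; SqAdj; ι₂)

    splitSq : SqV → Outer ⊎ Fixed ⊎ Outer
    splitSq (inj₁ u)       = copy₁ (Idx.to u)
    splitSq (inj₂ (u , _)) = copy₂ (Idx.to u)

    joinSq : Outer ⊎ Fixed ⊎ Outer → SqV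
    joinSq (inj₁ a)        = inj₁ (Idx.from (inj₁ a))
    joinSq (inj₂ (inj₁ f)) = inj₁ (Idx.from (inj₂ f))
    joinSq (inj₂ (inj₂ a)) = inj₂ (Idx.from (inj₁ a) , unlabeled P (λ i → label≢outer a i))

    joinSq-copy₁ : ∀ w → joinSq (copy₁ w) ≡ inj₁ (Idx.from w)
    joinSq-copy₁ (inj₁ _) = refl
    joinSq-copy₁ (inj₂ _) = refl

    joinSq-copy₂ : ∀ w → joinSq (copy₂ w) ≡ ι₂ (Idx.from w)
    joinSq-copy₂ (inj₁ a) = sym (ι₂-unlabeled P _ _)
    joinSq-copy₂ (inj₂ f) = sym (ι₂-vert P (Inverse.from enumFixed f)
                                  (cong (Idx.from ∘ inj₂) (Inverse.strictlyInverseˡ enumFixed f)))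

    split∘join : ∀ c → splitSq (joinSq c) ≡ c
    split∘join (inj₁ a)        = cong copy₁ (Idx.strictlyInverseˡ (inj₁ a))
    split∘join (inj₂ (inj₁ f)) = cong copy₁ (Idx.strictlyInverseˡ (inj₂ f))
    split∘join (inj₂ (inj₂ a)) = cong copy₂ (Idx.strictlyInverseˡ (inj₁ a))

    join∘split : ∀ s → joinSq (splitSq s) ≡ s
    join∘split (inj₁ u)       = trans (joinSq-copy₁ (Idx.to u)) (cong inj₁ (Idx.strictlyInverseʳ u))
    join∘split (inj₂ (u , p)) = begin
      joinSq (copy₂ (Idx.to u))  ≡⟨ joinSq-copy₂ (Idx.to u) ⟩
      ι₂ (Idx.from (Idx.to u))   ≡⟨ cong ι₂ (Idx.strictlyInverseʳ u) ⟩
      ι₂ u                       ≡⟨ ι₂-unlabeled P u p ⟩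
      inj₂ (u , p)               ∎
      where open ≡-Reasoning

    splitSq-ι₂ : ∀ u → splitSq (ι₂ u) ≡ copy₂ (Idx.to u)
    splitSq-ι₂ u = begin
      splitSq (ι₂ u)                       ≡⟨ cong (splitSq ∘ ι₂) (sym (Idx.strictlyInverseʳ u)) ⟩
      splitSq (ι₂ (Idx.from (Idx.to u)))   ≡⟨ cong splitSq (sym (joinSq-copy₂ (Idx.to u))) ⟩
      splitSq (joinSq (copy₂ (Idx.to u)))  ≡⟨ split∘join (copy₂ (Idx.to u)) ⟩
      copy₂ (Idx.to u)                     ∎
      where open ≡-Reasoning

    Adj-H-from : ∀ w w′ → Adj G (Vtx.to (copy₁ w)) (Vtx.to (copy₁ w′)) →
                 SimpleGraph.Adj H (Idx.from w) (Idx.from w′)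
    Adj-H-from w w′ = subst₂ (λ c d → Adj G (Vtx.to (copy₁ c)) (Vtx.to (copy₁ d)))
                             (sym (Idx.strictlyInverseˡ w)) (sym (Idx.strictlyInverseˡ w′))

    first-copy : ∀ w w′ → Adj G (Vtx.to (copy₁ w)) (Vtx.to (copy₁ w′)) →
                 SqAdj (joinSq (copy₁ w)) (joinSq (copy₁ w′))
    first-copy w w′ adj =
      inj₁ (Idx.from w , Idx.from w′ , Adj-H-from w w′ adj , sym (joinSq-copy₁ w) , sym (joinSq-copy₁ w′))

    second-copy : ∀ w w′ → Adj G (Vtx.to (copy₂ w)) (Vtx.to (copy₂ w′)) →
                  SqAdj (joinSq (copy₂ w)) (joinSq (copy₂ w′))
    second-copy w w′ adj =
      inj₂ (Idx.from w , Idx.from w′ , Adj-H-from w w′ (Equivalence.from (copies-agree w w′) adj)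
           , sym (joinSq-copy₂ w) , sym (joinSq-copy₂ w′))

    Adj⇒SqAdj : ∀ c d → Adj G (Vtx.to c) (Vtx.to d) → SqAdj (joinSq c) (joinSq d)
    Adj⇒SqAdj (inj₁ a)        (inj₁ a′)        = first-copy (inj₁ a) (inj₁ a′)
    Adj⇒SqAdj (inj₁ a)        (inj₂ (inj₁ f′)) = first-copy (inj₁ a) (inj₂ f′)
    Adj⇒SqAdj (inj₁ a)        (inj₂ (inj₂ a′)) = ⊥-elim ∘ no-cross-edges a a′
    Adj⇒SqAdj (inj₂ (inj₁ f)) (inj₁ a′)        = first-copy (inj₂ f) (inj₁ a′)
    Adj⇒SqAdj (inj₂ (inj₁ f)) (inj₂ (inj₁ f′)) = first-copy (inj₂ f) (inj₂ f′)
    Adj⇒SqAdj (inj₂ (inj₁ f)) (inj₂ (inj₂ a′)) = second-copy (inj₂ f) (inj₁ a′)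
    Adj⇒SqAdj (inj₂ (inj₂ a)) (inj₁ a′)        = ⊥-elim ∘ no-cross-edges a′ a ∘ Adj-sym _ _
    Adj⇒SqAdj (inj₂ (inj₂ a)) (inj₂ (inj₁ f′)) = second-copy (inj₁ a) (inj₂ f′)
    Adj⇒SqAdj (inj₂ (inj₂ a)) (inj₂ (inj₂ a′)) = second-copy (inj₁ a) (inj₁ a′)

    SqAdj⇒Adj : ∀ {s s′} → SqAdj s s′ → Adj G (Vtx.to (splitSq s)) (Vtx.to (splitSq s′))
    SqAdj⇒Adj (inj₁ (_ , _ , adj , refl , refl)) = adj
    SqAdj⇒Adj (inj₂ (u , w , adj , refl , refl)) =
      subst₂ (λ c d → Adj G (Vtx.to c) (Vtx.to d)) (sym (splitSq-ι₂ u)) (sym (splitSq-ι₂ w))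
             (Equivalence.to (copies-agree (Idx.to u) (Idx.to w)) adj)

    square-vertices : V G ↔ SqV
    square-vertices = ↔-trans (↔-sym vertices) (mk↔ₛ′ joinSq splitSq join∘split split∘join)

  SquareDecomposition⇒IsSquare : IsSquare G
  SquareDecomposition⇒IsSquare = P , record
    { bij      = ↔⇒⤖ square-vertices
    ; preserve = λ x y → Adj⇒SqAdj (Vtx.from x) (Vtx.from y)
                       ∘ subst₂ (Adj G) (sym (Vtx.strictlyInverseˡ x)) (sym (Vtx.strictlyInverseˡ y))
    ; reflect  = λ x y → subst₂ (Adj G) (round-trip x) (round-trip y) ∘ SqAdj⇒Adj
    }
    where
    round-trip : ∀ x → Vtx.to (splitSq (joinSq (Vtx.from x))) ≡ x
    round-trip x = trans (cong Vtx.to (split∘join (Vtx.from x))) (Vtx.strictlyInverseˡ x)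

Q-Adj-sym : ∀ {n} (x y : Vec Bool n) → Adj (Q n) x y → Adj (Q n) y x
Q-Adj-sym _ _ (i , xᵢ≢yᵢ , rest) = i , xᵢ≢yᵢ ∘ sym , λ j j≢i → sym (rest j j≢i)

Q-Adj-irrefl : ∀ {n} (x : Vec Bool n) → ¬ Adj (Q n) x x
Q-Adj-irrefl _ (_ , xᵢ≢xᵢ , _) = xᵢ≢xᵢ refl

Q-¬Adj-two-differences : ∀ {n} (x y : Vec Bool n) {i j} → i ≢ j →
  lookup x i ≢ lookup y i → lookup x j ≢ lookup y j → ¬ Adj (Q n) x y
Q-¬Adj-two-differences _ _ {i} {j} i≢j xᵢ≢yᵢ xⱼ≢yⱼ (k , _ , rest) with i ≟ k
... | yes refl = xⱼ≢yⱼ (rest j (i≢j ∘ sym))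
... | no i≢k   = xᵢ≢yᵢ (rest i i≢k)

Q-Adj-permute : ∀ {n} (π : Permutation′ n) (x y x′ y′ : Vec Bool n) →
  (∀ j → lookup x′ j ≡ lookup x (π ⟨$⟩ʳ j)) → (∀ j → lookup y′ j ≡ lookup y (π ⟨$⟩ʳ j)) →
  Adj (Q n) x y → Adj (Q n) x′ y′
Q-Adj-permute π x y x′ y′ x′≗xπ y′≗yπ (i , xᵢ≢yᵢ , rest) = π ⟨$⟩ˡ i , differ , agree
  where
  open ≡-Reasoning
  differ : lookup x′ (π ⟨$⟩ˡ i) ≢ lookup y′ (π ⟨$⟩ˡ i)
  differ e = xᵢ≢yᵢ (begin
    lookup x i                     ≡⟨ cong (lookup x) (sym (inverseʳ π)) ⟩
    lookup x (π ⟨$⟩ʳ (π ⟨$⟩ˡ i))   ≡⟨ sym (x′≗xπ (π ⟨$⟩ˡ i)) ⟩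
    lookup x′ (π ⟨$⟩ˡ i)           ≡⟨ e ⟩
    lookup y′ (π ⟨$⟩ˡ i)           ≡⟨ y′≗yπ (π ⟨$⟩ˡ i) ⟩
    lookup y (π ⟨$⟩ʳ (π ⟨$⟩ˡ i))   ≡⟨ cong (lookup y) (inverseʳ π) ⟩
    lookup y i                     ∎)
  agree : ∀ j → j ≢ π ⟨$⟩ˡ i → lookup x′ j ≡ lookup y′ j
  agree j j≢ = begin
    lookup x′ j          ≡⟨ x′≗xπ j ⟩
    lookup x (π ⟨$⟩ʳ j)  ≡⟨ rest (π ⟨$⟩ʳ j) (λ e → j≢ (trans (sym (inverseˡ π)) (cong (π ⟨$⟩ˡ_) e))) ⟩
    lookup y (π ⟨$⟩ʳ j)  ≡⟨ sym (y′≗yπ j) ⟩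
    lookup y′ j          ∎

swap₀₁ : ∀ {A : Set} {n} → Vec A (2 + n) → Vec A (2 + n)
swap₀₁ (a ∷ b ∷ x) = b ∷ a ∷ x

lookup-swap₀₁ : ∀ {A : Set} {n} (x : Vec A (2 + n)) j →
                lookup (swap₀₁ x) j ≡ lookup x (transpose 0F 1F ⟨$⟩ʳ j)
lookup-swap₀₁ (a ∷ b ∷ x) 0F            = refl
lookup-swap₀₁ (a ∷ b ∷ x) (suc 0F)      = refl
lookup-swap₀₁ (a ∷ b ∷ x) (suc (suc j)) = refl

Q-Adj-swap₀₁ : ∀ {n} (x y : Vec Bool (2 + n)) →
               Adj (Q (2 + n)) x y → Adj (Q (2 + n)) (swap₀₁ x) (swap₀₁ y)
Q-Adj-swap₀₁ x y = Q-Adj-permute (transpose 0F 1F) x y (swap₀₁ x) (swap₀₁ y)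
                                  (lookup-swap₀₁ x) (lookup-swap₀₁ y)

Fin[2^n]↔Vec[Bool] : ∀ n → Fin (2 ^ n) ↔ Vec Bool n
Fin[2^n]↔Vec[Bool] n = ↔-trans (Fin[m^n]↔Fin[m]^n 2 n) (↔-trans (lift↔ n 2↔Bool) (↔Vec n))

module _ (n : ℕ) where
  private
    Layers : Set
    Layers = Vec Bool n ⊎ Vec Bool (suc n) ⊎ Vec Bool n

    glue : Layers → Vec Bool (2 + n)
    glue (inj₁ x)              = false ∷ true ∷ x
    glue (inj₂ (inj₁ (b ∷ x))) = b ∷ b ∷ x
    glue (inj₂ (inj₂ x))       = true ∷ false ∷ x

    cut : Vec Bool (2 + n) → Layers
    cut (false ∷ true  ∷ x) = inj₁ x
    cut (false ∷ false ∷ x) = inj₂ (inj₁ (false ∷ x))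
    cut (true  ∷ true  ∷ x) = inj₂ (inj₁ (true ∷ x))
    cut (true  ∷ false ∷ x) = inj₂ (inj₂ x)

    glue∘cut : ∀ x → glue (cut x) ≡ x
    glue∘cut (false ∷ true  ∷ x) = refl
    glue∘cut (false ∷ false ∷ x) = refl
    glue∘cut (true  ∷ true  ∷ x) = refl
    glue∘cut (true  ∷ false ∷ x) = refl

    cut∘glue : ∀ c → cut (glue c) ≡ c
    cut∘glue (inj₁ x)                  = refl
    cut∘glue (inj₂ (inj₁ (false ∷ x))) = refl
    cut∘glue (inj₂ (inj₁ (true ∷ x)))  = refl
    cut∘glue (inj₂ (inj₂ x))           = refl

    swap₀₁-copy₁ : ∀ w → swap₀₁ (glue (copy₁ w)) ≡ glue (copy₂ w)
    swap₀₁-copy₁ (inj₁ _)       = refl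
    swap₀₁-copy₁ (inj₂ (_ ∷ _)) = refl

    swap₀₁-copy₂ : ∀ w → swap₀₁ (glue (copy₂ w)) ≡ glue (copy₁ w)
    swap₀₁-copy₂ (inj₁ _)       = refl
    swap₀₁-copy₂ (inj₂ (_ ∷ _)) = refl

    swap₀₁-transfer : {c c′ : Vec Bool n ⊎ Vec Bool (suc n) → Layers} →
      (∀ w → swap₀₁ (glue (c w)) ≡ glue (c′ w)) →
      ∀ w w′ → Adj (Q (2 + n)) (glue (c w)) (glue (c w′)) → Adj (Q (2 + n)) (glue (c′ w)) (glue (c′ w′))
    swap₀₁-transfer {c} swap-c w w′ =
      subst₂ (Adj (Q (2 + n))) (swap-c w) (swap-c w′) ∘ Q-Adj-swap₀₁ (glue (c w)) (glue (c w′))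

  hypercube-decomposition : SquareDecomposition (Q (2 + n))
  hypercube-decomposition = record
    { Outer          = Vec Bool n
    ; Fixed          = Vec Bool (suc n)
    ; #outer         = 2 ^ n
    ; #fixed         = 2 ^ suc n
    ; enumOuter      = Fin[2^n]↔Vec[Bool] n
    ; enumFixed      = Fin[2^n]↔Vec[Bool] (suc n)
    ; outer₀         = replicate n false
    ; fixed₀         = replicate (suc n) false
    ; vertices       = mk↔ₛ′ glue cut glue∘cut cut∘glue
    ; copies-agree   = λ w w′ → mk⇔ (swap₀₁-transfer {copy₁} swap₀₁-copy₁ w w′)
                                        (swap₀₁-transfer {copy₂} swap₀₁-copy₂ w w′)
    ; no-cross-edges = λ a a′ → Q-¬Adj-two-differences (false ∷ true ∷ a) (true ∷ false ∷ a′) {0F} {1F}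
                                                (λ ()) (λ ()) (λ ())
    }

theorem5p1 : (n : ℕ) → n ≥ 2 → IsSquare (Q n)
theorem5p1 0 ()
theorem5p1 1 (s≤s ())
theorem5p1 (suc (suc n)) _ =
  SquareDecomposition⇒IsSquare Q-Adj-sym Q-Adj-irrefl (hypercube-decomposition n)
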